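{- Let $\mathcal{N}$ be an $(n-1)$-maniplex with an $\ell$-colouring $\mathcal{C}$, and let $\mathcal{M}=2^{(\mathcal{N},\mathcal{C})}$. Then the antipodal colouring $\mathcal{C}^\times$ of $\mathcal{M}$ is $\mathrm{Aut}(\mathcal{M})$-invariant.
   Context: An $n$-maniplex is a connected $n$-valent simple graph with a proper edge-colouring by $\{0,\dots,n-1\}$ such that whenever $|i-j|>1$ the edges of colours $i,j$ form a disjoint union of $4$-cycles; vertices are flags, $u^i$ is the $i$-neighbour of $u$, automorphisms are colour-preserving graph automorphisms. The facets of an $n$-maniplex are the connected components of the subgraph obtained by deleting the edges of colour $n-1$. An $\ell$-colouring is a surjective function $\mathcal{C}$ from the set of facets to $\{1,\dots,\ell\}$; the colour of a flag is that of its facet. The colour-coded extension $2^{(\mathcal{N},\mathcal{C})}$ of an $(n-1)$-maniplex $\mathcal{N}$ with flag set $\mathcal{F}$ is the $n$-maniplex with flag set $\mathcal{F}\times\mathbb{Z}_2^\ell$ where $(u,x)^i=(u^i,x)$ for $i<n-1$ and $(u,x)^{n-1}=(u,x^j)$ with $j$ the colour of $u$ and $x^j$ the element differing from $x$ only in its $j$-th coordinate. Its facets are $F_x$ ($x\in\mathbb{Z}_2^\ell$), consisting of the flags with second coordinate $x$. Two facets $F_x,F_y$ are antipodal if $x$ and $y$ differ in every coordinate; the antipodal colouring $\mathcal{C}^\times$ gives two distinct facets the same colour if and only if they are antipodal. A colouring $\mathcal{C}'$ of a maniplex $\mathcal{M}$ is $\mathrm{Aut}(\mathcal{M})$-invariant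 if for every $\varphi\in\mathrm{Aut}(\mathcal{M})$ the assignment $\mathcal{C}'(F)\mapsto\mathcal{C}'(F\varphi)$ is a well-defined bijection of the set of colours. -}

module Defs where

open import Data.Nat using (ℕ; zero; suc; _<_)
open import Data.Fin using (Fin; zero; suc; toℕ)
open import Data.Bool using (Bool; true; false; not)
open import Data.Vec using (Vec; []; _∷_; updateAt; map)
open import Data.List using (List; []; _∷_)
open import Data.Maybe using (Maybe; just; nothing)
open import Data.Product using (_×_; _,_; ∃)
open import Relation.Binary.PropositionalEquality using (_≡_; _≢_)

applyWord : ∀ {n} {F : Set} → (Fin n → F → F) → List (Fin n) → F → F
applyWord r []      u = u
applyWord r (i ∷ w) u = applyWord r w (r i u)

-- An n-maniplex: flags with, for each colour i, the i-neighbour map u ↦ u^i.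
--  * invol/loopless/simple: the i-edges form a perfect matching with no loops,
--    and distinct colours give distinct neighbours (simple, n-valent, proper colouring);
--  * comm: for |i-j|>1 the i,j edges form 4-cycles u, u^i, u^{ij}=u^{ji}, u^j
--    (distinctness of the four vertices follows from loopless/simple);
--  * connected: any two flags are joined by a path.
record Maniplex (n : ℕ) : Set₁ where
  field
    Flag      : Set
    r         : Fin n → Flag → Flag
    invol     : ∀ i u → r i (r i u) ≡ u
    loopless  : ∀ i u → r i u ≢ u
    simple    : ∀ i j u → r i u ≡ r j u → i ≡ j
    comm      : ∀ i j → suc (toℕ i) < toℕ j → ∀ u → r i (r j u) ≡ r j (r i u)
    connected : ∀ u v → ∃ λ (w : List (Fin n)) → applyWord r w u ≡ v

-- An ℓ-colouring of an m-maniplex (colours Fin ℓ ≅ {1,…,ℓ}): a surjective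
-- function on facets, i.e. a function on flags that is constant on facets
-- (invariant under u ↦ u^i for every colour i < m-1) and surjective.
record Colouring {m : ℕ} (N : Maniplex m) (ℓ : ℕ) : Set where
  open Maniplex N
  field
    col        : Flag → Fin ℓ
    facetConst : ∀ i u → suc (toℕ i) < m → col (r i u) ≡ col u
    surj       : ∀ c → ∃ λ u → col u ≡ c

record ColGraph (n : ℕ) : Set₁ where
  field
    Flag : Set
    r    : Fin n → Flag → Flag

belowTop : ∀ {m} → Fin (suc m) → Maybe (Fin m)
belowTop {zero}  zero    = nothing
belowTop {suc m} zero    = just zero
belowTop {suc m} (suc i) = Data.Maybe.map suc (belowTop i)

flipAt : ∀ {ℓ} → Fin ℓ → Vec Bool ℓ → Vec Bool ℓ
flipAt j x = updateAt x j not

extNeighbour : ∀ {m ℓ} (N : Maniplex m) (C : Colouring N ℓ) →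
               Fin (suc m) → Maniplex.Flag N × Vec Bool ℓ → Maniplex.Flag N × Vec Bool ℓ
extNeighbour N C i (u , x) with belowTop i
... | just j  = (Maniplex.r N j u , x)
... | nothing = (u , flipAt (Colouring.col C u) x)

colourCodedExt : ∀ {m ℓ} (N : Maniplex m) → Colouring N ℓ → ColGraph (suc m)
colourCodedExt {m} {ℓ} N C = record
  { Flag = Maniplex.Flag N × Vec Bool ℓ
  ; r    = extNeighbour N C }

record Aut {n : ℕ} (G : ColGraph n) : Set where
  open ColGraph G
  field
    to      : Flag → Flag
    from    : Flag → Flag
    to-from : ∀ u → to (from u) ≡ u
    from-to : ∀ u → from (to u) ≡ u
    preserve : ∀ i u → to (r i u) ≡ r i (to u)

-- Antipodal colouring of 2^(N,C): facet F_x gets colour {x, x̄}, represented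
-- canonically (first coordinate made false). Thus distinct facets F_x, F_y get
-- the same colour iff x and y differ in every coordinate.
antipodalRep : ∀ {ℓ} → Vec Bool ℓ → Vec Bool ℓ
antipodalRep []           = []
antipodalRep (false ∷ xs) = false ∷ xs
antipodalRep (true ∷ xs)  = false ∷ map not xs

antipodalColouring : ∀ {m ℓ} (N : Maniplex m) (C : Colouring N ℓ) →
                     ColGraph.Flag (colourCodedExt N C) → Vec Bool ℓ
antipodalColouring N C (u , x) = antipodalRep x

-- Aut(G)-invariance of a colouring given as a function `col` on flags that is
-- constant on facets (colour of a flag = colour of its facet; the colour set is
-- the image of col). For each automorphism φ, the assignment col(F) ↦ col(Fφ)
-- must be a well-defined bijection of the set of colours.
AutInvariant : ∀ {n} (G : ColGraph n) {K : Set} → (ColGraph.Flag G → K) → Set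
AutInvariant G col =
  (φ : Aut G) →
    let f = Aut.to φ in
    (∀ u v → col u ≡ col v → col (f u) ≡ col (f v))
    × (∀ u v → col (f u) ≡ col (f v) → col u ≡ col v)
    × (∀ v → ∃ λ u → col (f u) ≡ col v)

{-# OPTIONS --safe #-}
module Submission where

-- An automorphism of 2^(N,C) permutes the facets F_x: flags of one facet are joined by
-- words avoiding the top colour, since N is connected. As C is surjective, for every j
-- some top-coloured edge joins F_x and F_{x^j}, so the induced permutation of ℤ₂^ℓ maps
-- hypercube edges to hypercube edges and hence does not increase Hamming distance. The
-- same holds for the inverse automorphism, so distance ℓ, attained exactly by antipodal
-- pairs, is preserved.

open import Defs
open import Data.Nat using (ℕ; zero; suc; _≤_; z≤n; s≤s)
open import Data.Nat.Properties using (≤-refl; ≤-reflexive; ≤-trans; m≤n⇒m≤1+n; n≤1+n; suc-injective; n≮n; module ≤-Reasoning)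
open import Data.Fin using (Fin; zero; suc; inject₁; fromℕ)
open import Data.Bool using (Bool; true; false; not)
open import Data.Bool.Properties using (not-involutive)
open import Data.Vec using (Vec; []; _∷_; map)
open import Data.Vec.Properties using (∷-injectiveʳ; map-∘; map-cong; map-id; updateAt-updateAt-local; updateAt-id)
open import Data.List using ([]; _∷_)
import Data.List as List
open import Data.Maybe using (just; nothing)
open import Data.Product using (_×_; _,_; ∃; proj₁; proj₂)
open import Data.Sum using (_⊎_; inj₁; inj₂)
open import Data.Empty using (⊥-elim)
open import Function using (_∘_)
open import Relation.Binary.PropositionalEquality

private
  variable
    n : ℕ

map-not-involutive : (x : Vec Bool n) → map not (map not x) ≡ x
map-not-involutive x = trans (sym (map-∘ not not x)) (trans (map-cong not-involutive x) (map-id x))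

flipAt-involutive : (j : Fin n) (x : Vec Bool n) → flipAt j (flipAt j x) ≡ x
flipAt-involutive j x = trans (updateAt-updateAt-local j x (not-involutive _)) (updateAt-id j x)

hamming : Vec Bool n → Vec Bool n → ℕ
hamming []          []          = 0
hamming (false ∷ x) (false ∷ y) = hamming x y
hamming (true  ∷ x) (true  ∷ y) = hamming x y
hamming (false ∷ x) (true  ∷ y) = suc (hamming x y)
hamming (true  ∷ x) (false ∷ y) = suc (hamming x y)

hamming-self : (x : Vec Bool n) → hamming x x ≡ 0
hamming-self []          = refl
hamming-self (false ∷ x) = hamming-self x
hamming-self (true  ∷ x) = hamming-self x

hamming≡0⇒≡ : (x y : Vec Bool n) → hamming x y ≡ 0 → x ≡ y
hamming≡0⇒≡ []          []          _ = refl
hamming≡0⇒≡ (false ∷ x) (false ∷ y) e = cong (false ∷_) (hamming≡0⇒≡ x y e)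
hamming≡0⇒≡ (true  ∷ x) (true  ∷ y) e = cong (true ∷_) (hamming≡0⇒≡ x y e)

hamming-flipAt : (j : Fin n) (x y : Vec Bool n) → hamming x (flipAt j y) ≤ suc (hamming x y)
hamming-flipAt zero    (false ∷ x) (false ∷ y) = ≤-refl
hamming-flipAt zero    (true  ∷ x) (true  ∷ y) = ≤-refl
hamming-flipAt zero    (false ∷ x) (true  ∷ y) = m≤n⇒m≤1+n (n≤1+n _)
hamming-flipAt zero    (true  ∷ x) (false ∷ y) = m≤n⇒m≤1+n (n≤1+n _)
hamming-flipAt (suc j) (false ∷ x) (false ∷ y) = hamming-flipAt j x y
hamming-flipAt (suc j) (true  ∷ x) (true  ∷ y) = hamming-flipAt j x y
hamming-flipAt (suc j) (false ∷ x) (true  ∷ y) = s≤s (hamming-flipAt j x y)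
hamming-flipAt (suc j) (true  ∷ x) (false ∷ y) = s≤s (hamming-flipAt j x y)

hamming-suc⇒flipAt-closer : ∀ (x y : Vec Bool n) d → hamming x y ≡ suc d →
                            ∃ λ j → hamming x (flipAt j y) ≡ d
hamming-suc⇒flipAt-closer []          []          d ()
hamming-suc⇒flipAt-closer (false ∷ x) (false ∷ y) d e with hamming-suc⇒flipAt-closer x y d e
... | j , e′ = suc j , e′
hamming-suc⇒flipAt-closer (true  ∷ x) (true  ∷ y) d e with hamming-suc⇒flipAt-closer x y d e
... | j , e′ = suc j , e′
hamming-suc⇒flipAt-closer (false ∷ x) (true  ∷ y) d e = zero , suc-injective e
hamming-suc⇒flipAt-closer (true  ∷ x) (false ∷ y) d e = zero , suc-injective e

hamming≤length : (x y : Vec Bool n) → hamming x y ≤ n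
hamming≤length []          []          = z≤n
hamming≤length (false ∷ x) (false ∷ y) = m≤n⇒m≤1+n (hamming≤length x y)
hamming≤length (true  ∷ x) (true  ∷ y) = m≤n⇒m≤1+n (hamming≤length x y)
hamming≤length (false ∷ x) (true  ∷ y) = s≤s (hamming≤length x y)
hamming≤length (true  ∷ x) (false ∷ y) = s≤s (hamming≤length x y)

length≤hamming⇒antipode : (x y : Vec Bool n) → n ≤ hamming x y → y ≡ map not x
length≤hamming⇒antipode []          []          _       = refl
length≤hamming⇒antipode (false ∷ x) (false ∷ y) n<d     = ⊥-elim (n≮n _ (≤-trans n<d (hamming≤length x y)))
length≤hamming⇒antipode (true  ∷ x) (true  ∷ y) n<d     = ⊥-elim (n≮n _ (≤-trans n<d (hamming≤length x y)))
length≤hamming⇒antipode (false ∷ x) (true  ∷ y) (s≤s p) = cong (true ∷_) (length≤hamming⇒antipode x y p)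
length≤hamming⇒antipode (true  ∷ x) (false ∷ y) (s≤s p) = cong (false ∷_) (length≤hamming⇒antipode x y p)

hamming-antipode : (x : Vec Bool n) → hamming x (map not x) ≡ n
hamming-antipode []          = refl
hamming-antipode (false ∷ x) = cong suc (hamming-antipode x)
hamming-antipode (true  ∷ x) = cong suc (hamming-antipode x)

EdgePreserving : (Vec Bool n → Vec Bool n) → Set
EdgePreserving h = ∀ j x → ∃ λ k → h (flipAt j x) ≡ flipAt k (h x)

Nonexpanding : (Vec Bool n → Vec Bool n) → Set
Nonexpanding h = ∀ x y → hamming (h x) (h y) ≤ hamming x y

edgePreserving⇒nonexpanding : {h : Vec Bool n → Vec Bool n} → EdgePreserving h → Nonexpanding h
edgePreserving⇒nonexpanding {h = h} edge x y = bound (hamming x y) y refl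
  where
  open ≤-Reasoning
  bound : ∀ d y → hamming x y ≡ d → hamming (h x) (h y) ≤ d
  bound zero y e = ≤-reflexive (begin-equality
    hamming (h x) (h y)  ≡⟨ cong (λ z → hamming (h z) (h y)) (hamming≡0⇒≡ x y e) ⟩
    hamming (h y) (h y)  ≡⟨ hamming-self (h y) ⟩
    0                    ∎)
  bound (suc d) y e with hamming-suc⇒flipAt-closer x y d e
  ... | j , e′ with edge j (flipAt j y)
  ... | k , h-edge = begin
    hamming (h x) (h y)                        ≡⟨ cong (hamming (h x) ∘ h) (sym (flipAt-involutive j y)) ⟩
    hamming (h x) (h (flipAt j (flipAt j y)))  ≡⟨ cong (hamming (h x)) h-edge ⟩
    hamming (h x) (flipAt k (h (flipAt j y)))  ≤⟨ hamming-flipAt k (h x) (h (flipAt j y)) ⟩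
    suc (hamming (h x) (h (flipAt j y)))       ≤⟨ s≤s (bound d (flipAt j y) e′) ⟩
    suc d                                      ∎

nonexpanding-leftInverse⇒antipode-preserving :
  {h g : Vec Bool n → Vec Bool n} → Nonexpanding g → (∀ x → g (h x) ≡ x) →
  ∀ x → h (map not x) ≡ map not (h x)
nonexpanding-leftInverse⇒antipode-preserving {n} {h} {g} g-nonexp gh≡id x =
  length≤hamming⇒antipode (h x) (h (map not x)) (begin
    n                                          ≡⟨ sym (hamming-antipode x) ⟩
    hamming x (map not x)                      ≡⟨ sym (cong₂ hamming (gh≡id x) (gh≡id (map not x))) ⟩
    hamming (g (h x)) (g (h (map not x)))      ≤⟨ g-nonexp (h x) (h (map not x)) ⟩
    hamming (h x) (h (map not x))              ∎)
  where open ≤-Reasoning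

antipodalRep-fibre : (x y : Vec Bool n) → antipodalRep x ≡ antipodalRep y → x ≡ y ⊎ y ≡ map not x
antipodalRep-fibre []          []          _ = inj₁ refl
antipodalRep-fibre (false ∷ x) (false ∷ y) e = inj₁ e
antipodalRep-fibre (true  ∷ x) (true  ∷ y) e = inj₁ (cong (true ∷_) (begin
  x                    ≡⟨ sym (map-not-involutive x) ⟩
  map not (map not x)  ≡⟨ cong (map not) (∷-injectiveʳ e) ⟩
  map not (map not y)  ≡⟨ map-not-involutive y ⟩
  y                    ∎))
  where open ≡-Reasoning
antipodalRep-fibre (false ∷ x) (true  ∷ y) e = inj₂ (cong (true ∷_) (begin
  y                    ≡⟨ sym (map-not-involutive y) ⟩
  map not (map not y)  ≡⟨ cong (map not) (sym (∷-injectiveʳ e)) ⟩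
  map not x            ∎))
  where open ≡-Reasoning
antipodalRep-fibre (true  ∷ x) (false ∷ y) e = inj₂ (sym e)

antipodalRep-map-not : (x : Vec Bool n) → antipodalRep (map not x) ≡ antipodalRep x
antipodalRep-map-not []          = refl
antipodalRep-map-not (false ∷ x) = cong (false ∷_) (map-not-involutive x)
antipodalRep-map-not (true  ∷ x) = refl

applyWord-commute : ∀ {F : Set} {r : Fin n → F → F} (f : F → F) →
                    (∀ i u → f (r i u) ≡ r i (f u)) →
                    ∀ w u → f (applyWord r w u) ≡ applyWord r w (f u)
applyWord-commute f f-commute []      u = refl
applyWord-commute f f-commute (i ∷ w) u =
  trans (applyWord-commute f f-commute w _) (cong (applyWord _ w) (f-commute i u))

Aut⁻¹ : {G : ColGraph n} → Aut G → Aut G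
Aut⁻¹ {G = G} φ = record
  { to       = from
  ; from     = to
  ; to-from  = from-to
  ; from-to  = to-from
  ; preserve = λ i u → begin
      from (r i u)                ≡⟨ cong (from ∘ r i) (sym (to-from u)) ⟩
      from (r i (to (from u)))    ≡⟨ cong from (sym (preserve i (from u))) ⟩
      from (to (r i (from u)))    ≡⟨ from-to _ ⟩
      r i (from u)                ∎
  }
  where
  open Aut φ
  open ColGraph G
  open ≡-Reasoning

belowTop-inject₁ : (i : Fin n) → belowTop (inject₁ i) ≡ just i
belowTop-inject₁ {suc n} zero    = refl
belowTop-inject₁ {suc n} (suc i) rewrite belowTop-inject₁ i = refl

belowTop-fromℕ : ∀ n → belowTop (fromℕ n) ≡ nothing
belowTop-fromℕ zero    = refl
belowTop-fromℕ (suc n) rewrite belowTop-fromℕ n = refl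

module ColourCodedExtension {m ℓ : ℕ} (N : Maniplex m) (C : Colouring N ℓ) where
  open Maniplex N
  open Colouring C

  M : ColGraph (suc m)
  M = colourCodedExt N C

  r⁺ : Fin (suc m) → Flag × Vec Bool ℓ → Flag × Vec Bool ℓ
  r⁺ = extNeighbour N C

  r⁺-inject₁ : ∀ i u x → r⁺ (inject₁ i) (u , x) ≡ (r i u , x)
  r⁺-inject₁ i u x rewrite belowTop-inject₁ i = refl

  r⁺-fromℕ : ∀ u x → r⁺ (fromℕ m) (u , x) ≡ (u , flipAt (col u) x)
  r⁺-fromℕ u x rewrite belowTop-fromℕ m = refl

  applyWord-inject₁ : ∀ w u x → applyWord r⁺ (List.map inject₁ w) (u , x) ≡ (applyWord r w u , x)
  applyWord-inject₁ []      u x = refl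
  applyWord-inject₁ (i ∷ w) u x rewrite r⁺-inject₁ i u x = applyWord-inject₁ w (r i u) x

  module _ (φ : Aut M) where
    open Aut φ

    facetMap : Flag → Vec Bool ℓ → Vec Bool ℓ
    facetMap u x = proj₂ (to (u , x))

    facetMap-independent : ∀ u v x → facetMap u x ≡ facetMap v x
    facetMap-independent u v x with connected u v
    ... | w , u↝v = begin
      proj₂ (to (u , x))                                            ≡⟨ sym (cong proj₂ (applyWord-inject₁ w _ _)) ⟩
      proj₂ (applyWord r⁺ (List.map inject₁ w) (to (u , x)))       ≡⟨ cong proj₂ (sym (applyWord-commute to preserve (List.map inject₁ w) (u , x))) ⟩
      proj₂ (to (applyWord r⁺ (List.map inject₁ w) (u , x)))       ≡⟨ cong (proj₂ ∘ to) (applyWord-inject₁ w u x) ⟩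
      proj₂ (to (applyWord r w u , x))                              ≡⟨ cong (λ v → proj₂ (to (v , x))) u↝v ⟩
      proj₂ (to (v , x))                                            ∎
      where open ≡-Reasoning

    facetMap-edgePreserving : ∀ u → EdgePreserving (facetMap u)
    facetMap-edgePreserving u j x with surj j
    ... | u′ , refl = col (proj₁ (to (u′ , x))) , (begin
      facetMap u (flipAt (col u′) x)                           ≡⟨ facetMap-independent u u′ _ ⟩
      proj₂ (to (u′ , flipAt (col u′) x))                      ≡⟨ cong (proj₂ ∘ to) (sym (r⁺-fromℕ u′ x)) ⟩
      proj₂ (to (r⁺ (fromℕ m) (u′ , x)))                       ≡⟨ cong proj₂ (preserve (fromℕ m) (u′ , x)) ⟩
      proj₂ (r⁺ (fromℕ m) (to (u′ , x)))                       ≡⟨ cong proj₂ (r⁺-fromℕ _ _) ⟩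
      flipAt (col (proj₁ (to (u′ , x)))) (facetMap u′ x)        ≡⟨ cong (flipAt _) (facetMap-independent u′ u x) ⟩
      flipAt (col (proj₁ (to (u′ , x)))) (facetMap u x)         ∎)
      where open ≡-Reasoning

  facetMap-leftInverse : ∀ φ u x → facetMap (Aut⁻¹ φ) u (facetMap φ u x) ≡ x
  facetMap-leftInverse φ u x =
    trans (facetMap-independent (Aut⁻¹ φ) u _ _) (cong proj₂ (Aut.from-to φ (u , x)))

  facetMap-antipode : ∀ φ u x → facetMap φ u (map not x) ≡ map not (facetMap φ u x)
  facetMap-antipode φ u =
    nonexpanding-leftInverse⇒antipode-preserving {g = facetMap (Aut⁻¹ φ) u}
      (edgePreserving⇒nonexpanding (facetMap-edgePreserving (Aut⁻¹ φ) u))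
      (facetMap-leftInverse φ u)

  antipodalColouring-respected : ∀ (φ : Aut M) p q →
    antipodalColouring N C p ≡ antipodalColouring N C q →
    antipodalColouring N C (Aut.to φ p) ≡ antipodalColouring N C (Aut.to φ q)
  antipodalColouring-respected φ (u , x) (v , y) e with antipodalRep-fibre x y e
  ... | inj₁ refl = cong antipodalRep (facetMap-independent φ u v x)
  ... | inj₂ refl = begin
    antipodalRep (facetMap φ u x)                       ≡⟨ sym (antipodalRep-map-not _) ⟩
    antipodalRep (map not (facetMap φ u x))             ≡⟨ cong antipodalRep (sym (facetMap-antipode φ u x)) ⟩
    antipodalRep (facetMap φ u (map not x))             ≡⟨ cong antipodalRep (facetMap-independent φ u v _) ⟩
    antipodalRep (facetMap φ v (map not x))             ∎
    where open ≡-Reasoning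

lemma4p1 : ∀ {m ℓ : ℕ} (N : Maniplex m) (C : Colouring N ℓ) →
    AutInvariant (colourCodedExt N C) (antipodalColouring N C)
lemma4p1 N C φ =
    antipodalColouring-respected φ
  , (λ p q e → subst₂ (λ p′ q′ → colour p′ ≡ colour q′) (from-to p) (from-to q)
                 (antipodalColouring-respected (Aut⁻¹ φ) (to p) (to q) e))
  , (λ q → from q , cong colour (to-from q))
  where
  open Aut φ
  open ColourCodedExtension N C
  colour = antipodalColouring N C
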